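{- Suppose that $\Pi$ is a derivation of $\vdash^{w}P:\mathtt{b}$ (empty context, $\mathtt{b}$ a type distribution) with $w>0$, and that $P\to\langle q_iP_i\rangle_{i\in I}$. Then for every $i\in I$ there exists a derivation $\Pi_i$ of $\vdash^{w_i}P_i:\mathtt{b}_i$ with $|\Pi|>|\Pi_i|$. Moreover, $\mathtt{b}=\bigsqcup_{i\in I}q_i\mathtt{b}_i$ and $w=1+\sum_{i\in I}q_iw_i$.
   Context: Terms: values $V ::= x \mid \lambda x.M$; terms $M ::= V \mid VV \mid M\oplus M \mid \mathtt{let}\ x = M\ \mathtt{in}\ M$; $M\{V/x\}$ is capture-avoiding substitution. A multidistribution on terms is a finite multiset $\langle p_iM_i\rangle_{i\in I}$ of pairs with $p_i\in(0,1]$ and $\sum_i p_i\le 1$. One-step reduction $\to$ from terms to multidistributions: $(\lambda x.M)V\to\langle 1\,M\{V/x\}\rangle$; $\mathtt{let}\ x=V\ \mathtt{in}\ M\to\langle 1\,M\{V/x\}\rangle$; $M\oplus N\to\langle\tfrac12 M,\tfrac12 N\rangle$; if $N\to\langle p_iN_i\rangle_{i\in I}$ then $\mathtt{let}\ x=N\ \mathtt{in}\ M\to\langle p_i(\mathtt{let}\ x=N_i\ \mathtt{in}\ M)\rangle_{i\in I}$. Types: arrow types $\mathtt{A} ::= \mathcal{M}\to \mathtt{a}$; intersection types $\mathcal{M} ::= [q_1\cdot \mathtt{A}_1,\dots,q_n\cdot\mathtt{A}_n]$ ($n\ge 0$), a finite multiset of pairs with scale factors $q_i\in(0,1]\cap\mathbb{Q}$;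 type distributions $\mathtt{a} ::= \langle p_1\mathcal{M}_1,\dots,p_n\mathcal{M}_n\rangle$ ($n\ge0$, $p_i\in(0,1]$, $\sum_i p_i\le 1$). $\mathbf{0}$ is the empty type distribution. For a scalar $u$, $u\cdot[q_i\cdot\mathtt{A}_i]_i=[(uq_i)\cdot \mathtt{A}_i]_i$ and $u\cdot\langle p_i\mathcal{M}_i\rangle_i=\langle (up_i)\mathcal{M}_i\rangle_i$; $\uplus$, $\sqcup$ are multiset unions. Typing contexts map variables to intersection types (finitely many nonempty), with pointwise $\uplus$ and scaling $q\cdot\Gamma$. Judgements $\Gamma\vdash^{w} M:\tau$ ($w\in\mathbb{Q}$) are derived by: (Var) $x:\mathcal{M}\vdash^0 x:\mathcal{M}$. (Zero) $\vdash^0 M:\mathbf{0}$. (@) from $\Gamma\vdash^{w}V:[1\cdot(\mathcal{M}\to\mathtt{b})]$ and $\Delta\vdash^{v}W:\mathcal{M}$ infer $\Gamma\uplus\Delta\vdash^{w+v}VW:\mathtt{b}$. ($\oplus$) from $\Gamma\vdash^{w}M:\mathtt{a}$, $\Delta\vdash^{v}N:\mathtt{b}$ infer $\tfrac12\cdot\Gamma\uplus\tfrac12\cdot\Delta\vdash^{\frac12 w+\frac12 v+1}M\oplus N:\tfrac12\mathtt{a}\sqcup\tfrac12\mathtt{b}$. ($\lambda$) from $\Gamma,x:\mathcal{M}\vdash^{w}M:\mathtt{b}$ infer $\Gamma\vdash^{w+1}\lambda x.M:\mathcal{M}\to\mathtt{b}$. (let) from $\Gamma\vdash^{v}N:\langle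 p_k\mathcal{M}_k\rangle_{k\in K}$ and $\Delta_k,x:\mathcal{M}_k\vdash^{w_k}M:\mathtt{b}_k$ ($k\in K$) infer $\Gamma\uplus_{k}p_k\cdot\Delta_k\vdash^{\sum_k p_kw_k+v+1}\mathtt{let}\ x=N\ \mathtt{in}\ M:\bigsqcup_k p_k\mathtt{b}_k$. (Val) from $\Gamma\vdash^{w}V:\mathcal{M}$ infer $\Gamma\vdash^{w}V:\langle 1\mathcal{M}\rangle$. (!) for finite possibly empty $I$, from $\Gamma_i\vdash^{w_i}V:\mathtt{A}_i$ and scale factors $q_i$ infer $\uplus_i q_i\cdot\Gamma_i\vdash^{\sum_i q_iw_i}V:[q_i\cdot\mathtt{A}_i]_{i\in I}$. The size $|\Pi|$ of a derivation is the number of rule instances in it, not counting instances of (!) and (Val). -}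

module Defs where

open import Data.Nat using (ℕ; suc)
open import Data.Fin using (Fin; zero; suc)
open import Data.Rational using (ℚ; 0ℚ; 1ℚ; ½; _+_; _*_; _<_; _≤_)
open import Data.Product using (_×_; _,_; proj₁; proj₂)
open import Data.List using (List; []; _∷_; _++_; map; foldr)
open import Data.Vec using (Vec; []; _∷_; replicate; zipWith; _[_]≔_)
open import Data.List.Relation.Binary.Permutation.Homogeneous using (Permutation)
open import Relation.Binary.PropositionalEquality using (_≡_)

-- Terms (well-scoped de Bruijn indices; index zero = innermost binder)

mutual
  data Val (n : ℕ) : Set where
    var : Fin n → Val n
    lam : Term (suc n) → Val n

  data Term (n : ℕ) : Set where
    val  : Val n → Term n
    app  : Val n → Val n → Term n
    _⊕_  : Term n → Term n → Term n
    letT : Term n → Term (suc n) → Term n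

mutual
  renV : ∀ {n m} → (Fin n → Fin m) → Val n → Val m
  renV ρ (var x) = var (ρ x)
  renV ρ (lam M) = lam (renT (extR ρ) M)

  renT : ∀ {n m} → (Fin n → Fin m) → Term n → Term m
  renT ρ (val V)    = val (renV ρ V)
  renT ρ (app V W)  = app (renV ρ V) (renV ρ W)
  renT ρ (M ⊕ N)    = renT ρ M ⊕ renT ρ N
  renT ρ (letT N M) = letT (renT ρ N) (renT (extR ρ) M)

  extR : ∀ {n m} → (Fin n → Fin m) → Fin (suc n) → Fin (suc m)
  extR ρ zero    = zero
  extR ρ (suc x) = suc (ρ x)

extS : ∀ {n m} → (Fin n → Val m) → Fin (suc n) → Val (suc m)
extS σ zero    = var zero
extS σ (suc x) = renV suc (σ x)

mutual
  subV : ∀ {n m} → (Fin n → Val m) → Val n → Val m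
  subV σ (var x) = σ x
  subV σ (lam M) = lam (subT (extS σ) M)

  subT : ∀ {n m} → (Fin n → Val m) → Term n → Term m
  subT σ (val V)    = val (subV σ V)
  subT σ (app V W)  = app (subV σ V) (subV σ W)
  subT σ (M ⊕ N)    = subT σ M ⊕ subT σ N
  subT σ (letT N M) = letT (subT σ N) (subT (extS σ) M)

single : ∀ {n} → Val n → Fin (suc n) → Val n
single V zero    = V
single V (suc x) = var x

_[_/0] : ∀ {n} → Term (suc n) → Val n → Term n
M [ V /0] = subT (single V) M

-- Multidistributions (finite multisets, represented by lists) and
-- one-step reduction

MDist : ℕ → Set
MDist n = List (ℚ × Term n)

infix 4 _⟶_
data _⟶_ {n : ℕ} : Term n → MDist n → Set where
  β     : ∀ {M V} → app (lam M) V ⟶ ((1ℚ , M [ V /0]) ∷ [])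
  letV  : ∀ {V M} → letT (val V) M ⟶ ((1ℚ , M [ V /0]) ∷ [])
  ⊕-red : ∀ {M N} → (M ⊕ N) ⟶ ((½ , M) ∷ (½ , N) ∷ [])
  letC  : ∀ {N M ds} → N ⟶ ds →
          letT N M ⟶ map (λ pN → proj₁ pN , letT (proj₂ pN) M) ds

-- Multisets are lists, compared by the equivalence ≈ below.

data AType : Set where
  _⇒_ : List (ℚ × AType) → List (ℚ × List (ℚ × AType)) → AType

IType : Set
IType = List (ℚ × AType)

TDist : Set
TDist = List (ℚ × IType)

𝟎 : TDist
𝟎 = []

mutual
  data _≈A_ : AType → AType → Set where
    ⇒-cong : ∀ {𝓜 𝓜′ a a′} → Permutation PairA 𝓜 𝓜′ → Permutation PairI a a′ →
             (𝓜 ⇒ a) ≈A (𝓜′ ⇒ a′)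

  data PairA : (ℚ × AType) → (ℚ × AType) → Set where
    pairA : ∀ {q q′ A A′} → q ≡ q′ → A ≈A A′ → PairA (q , A) (q′ , A′)

  data PairI : (ℚ × IType) → (ℚ × IType) → Set where
    pairI : ∀ {p p′ 𝓜 𝓜′} → p ≡ p′ → Permutation PairA 𝓜 𝓜′ → PairI (p , 𝓜) (p′ , 𝓜′)

_≈M_ : IType → IType → Set
_≈M_ = Permutation PairA

_≈D_ : TDist → TDist → Set
_≈D_ = Permutation PairI

sumℚ : List ℚ → ℚ
sumℚ = foldr _+_ 0ℚ

mutual
  data WFA : AType → Set where
    wf⇒ : ∀ {𝓜 a} → WFM 𝓜 → WFD a → WFA (𝓜 ⇒ a)

  data WFM : IType → Set where
    []  : WFM []
    _∷_ : ∀ {q A 𝓜} → (0ℚ < q × q ≤ 1ℚ × WFA A) → WFM 𝓜 → WFM ((q , A) ∷ 𝓜)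

  data WFD′ : TDist → Set where
    []  : WFD′ []
    _∷_ : ∀ {p 𝓜 a} → (0ℚ < p × p ≤ 1ℚ × WFM 𝓜) → WFD′ a → WFD′ ((p , 𝓜) ∷ a)

  data WFD : TDist → Set where
    wfD : ∀ {a} → WFD′ a → sumℚ (map proj₁ a) ≤ 1ℚ → WFD a

_·M_ : ℚ → IType → IType
u ·M 𝓜 = map (λ qA → u * proj₁ qA , proj₂ qA) 𝓜

_·D_ : ℚ → TDist → TDist
u ·D a = map (λ pM → u * proj₁ pM , proj₂ pM) a

Ctx : ℕ → Set
Ctx n = Vec IType n

∅ : ∀ {n} → Ctx n
∅ {n} = replicate n []

_⊎C_ : ∀ {n} → Ctx n → Ctx n → Ctx n
_⊎C_ = zipWith _++_

_·C_ : ∀ {n} → ℚ → Ctx n → Ctx n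
u ·C Γ = Data.Vec.map (u ·M_) Γ

[_∶_] : ∀ {n} → Fin n → IType → Ctx n
[ x ∶ 𝓜 ] = ∅ [ x ]≔ 𝓜

-- Typing derivations. DerT Γ M w a : Γ ⊢^w M : a ; DerM Γ V w 𝓜 : Γ ⊢^w V : 𝓜 ;
-- DerA Γ V w A : Γ ⊢^w V : A.

mutual
  data DerA {n : ℕ} : Ctx n → Val n → ℚ → AType → Set where
    λ-rule : ∀ {Γ 𝓜 M w b} → DerT (𝓜 ∷ Γ) M w b → DerA Γ (lam M) (w + 1ℚ) (𝓜 ⇒ b)

  data DerM {n : ℕ} : Ctx n → Val n → ℚ → IType → Set where
    var-rule  : ∀ {𝓜} (x : Fin n) → WFM 𝓜 → DerM [ x ∶ 𝓜 ] (var x) 0ℚ 𝓜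
    !-rule    : ∀ {Γ V w 𝓜} → Bang Γ V w 𝓜 → DerM Γ V w 𝓜

  -- the (finite, possibly empty) family of premises of (!)
  data Bang {n : ℕ} : Ctx n → Val n → ℚ → IType → Set where
    []   : ∀ {V} → Bang ∅ V 0ℚ []
    cons : ∀ {Γ Δ V w v A 𝓜} (q : ℚ) → 0ℚ < q → q ≤ 1ℚ →
           DerA Γ V w A → Bang Δ V v 𝓜 →
           Bang ((q ·C Γ) ⊎C Δ) V (q * w + v) ((q , A) ∷ 𝓜)

  data DerT {n : ℕ} : Ctx n → Term n → ℚ → TDist → Set where
    zero-rule : ∀ {M} → DerT ∅ M 0ℚ 𝟎
    app-rule    : ∀ {Γ Δ V W w v 𝓜 𝓜′ b} →
                DerM Γ V w ((1ℚ , (𝓜 ⇒ b)) ∷ []) → DerM Δ W v 𝓜′ → 𝓜 ≈M 𝓜′ →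
                DerT (Γ ⊎C Δ) (app V W) (w + v) b
    ⊕-rule    : ∀ {Γ Δ M N w v a b} → DerT Γ M w a → DerT Δ N v b →
                DerT ((½ ·C Γ) ⊎C (½ ·C Δ)) (M ⊕ N) (½ * w + ½ * v + 1ℚ) ((½ ·D a) ++ (½ ·D b))
    let-rule  : ∀ {Γ Δ N M v a ws bs} → DerT Γ N v a → Branches M a Δ ws bs →
                DerT (Γ ⊎C Δ) (letT N M) (ws + v + 1ℚ) bs
    val-rule  : ∀ {Γ V w 𝓜} → DerM Γ V w 𝓜 → DerT Γ (val V) w ((1ℚ , 𝓜) ∷ [])

  -- premises Δ_k, x : 𝓜_k ⊢^{w_k} M : b_k of (let), one per element p_k 𝓜_k of a;
  -- indices: accumulated context ⊎_k p_k·Δ_k, weight Σ_k p_k w_k, type ⊔_k p_k b_k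
  data Branches {n : ℕ} (M : Term (suc n)) : TDist → Ctx n → ℚ → TDist → Set where
    []   : Branches M [] ∅ 0ℚ []
    cons : ∀ {p 𝓜 𝓜′ Δ w b a Δs ws bs} →
           DerT (𝓜′ ∷ Δ) M w b → 𝓜′ ≈M 𝓜 → Branches M a Δs ws bs →
           Branches M ((p , 𝓜) ∷ a) ((p ·C Δ) ⊎C Δs) (p * w + ws) ((p ·D b) ++ bs)

-- size: number of rule instances, not counting (!) and (Val)
mutual
  sizeA : ∀ {n Γ V w A} → DerA {n} Γ V w A → ℕ
  sizeA (λ-rule Π) = suc (sizeT Π)

  sizeM : ∀ {n Γ V w 𝓜} → DerM {n} Γ V w 𝓜 → ℕ
  sizeM (var-rule x _) = 1
  sizeM (!-rule B)     = sizeB B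

  sizeB : ∀ {n Γ V w 𝓜} → Bang {n} Γ V w 𝓜 → ℕ
  sizeB []                  = 0
  sizeB (cons q _ _ Π B)    = sizeA Π Data.Nat.+ sizeB B

  sizeT : ∀ {n Γ M w a} → DerT {n} Γ M w a → ℕ
  sizeT zero-rule        = 1
  sizeT (app-rule Π Σ _)   = suc (sizeM Π Data.Nat.+ sizeM Σ)
  sizeT (⊕-rule Π Σ)     = suc (sizeT Π Data.Nat.+ sizeT Σ)
  sizeT (let-rule Π Bs)  = suc (sizeT Π Data.Nat.+ sizeBr Bs)
  sizeT (val-rule Π)     = sizeM Π

  sizeBr : ∀ {n M a Δ w b} → Branches {n} M a Δ w b → ℕ
  sizeBr []             = 0
  sizeBr (cons Π _ Bs)  = sizeT Π Data.Nat.+ sizeBr Bs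

module Submission where

-- For a β-redex, or a let whose bound term is a value, the (@) or (let) instance of the redex
-- and the (λ) instance of the abstraction disappear, and what remains is the substitution
-- lemma: a derivation of M with x : 𝓝 and a (!)-derivation of the closed value V : 𝓝 combine
-- into a derivation of M{V/x} whose weight is the sum of the two weights and whose size is at
-- most the sum of the two sizes. It is proved by induction on the derivation of M, splitting
-- the (!)-derivation along the multiset unions of contexts and undoing the rescalings of
-- contexts. For M ⊕ N the two premises are the derivations of the reducts. For let x = N in M
-- with N → ⟨qᵢNᵢ⟩, the induction hypothesis gives derivations of the Nᵢ with types aᵢ such that
-- the type of N is ⊔ qᵢaᵢ; regrouping the premises of (let) along this decomposition yields one
-- (let) derivation per reduct, and the new (let) instances cost Σ qᵢ = 1 in weight. Types and
-- contexts are multisets, so all of this holds up to permutation.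

open import Defs
open import Data.Nat using (_<_)
open import Data.Fin using (Fin)
open import Data.Rational using (ℚ; 0ℚ; 1ℚ; _+_; _*_) renaming (_<_ to _<ℚ_)
open import Data.Product using (Σ; _×_; _,_; proj₁; proj₂)
open import Data.List using (List; length; lookup; tabulate; concat; map)
open import Relation.Binary.PropositionalEquality using (_≡_)

open import Algebra.Bundles using (CommutativeMonoid)
import Algebra.Properties.CommutativeSemigroup as CommutativeSemigroupProperties
open import Data.Empty using (⊥)
open import Data.Fin using (zero; suc; fromℕ; inject₁)
open import Data.List using ([]; _∷_; _++_)
import Data.List.Properties as List
open import Data.List.Relation.Binary.Pointwise as Pointwise using (Pointwise; []; _∷_)
open import Data.List.Relation.Binary.Permutation.Homogeneous using (Permutation; refl; prep; swap; trans)
open import Data.List.Relation.Binary.Permutation.Propositional as ↭ using (_↭_)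
import Data.List.Relation.Binary.Permutation.Propositional.Properties as ↭
import Data.List.Relation.Binary.Permutation.Setoid.Properties as SetoidPermutation
open import Data.List.Relation.Unary.All using (All; []; _∷_)
open import Data.Nat as ℕ using (ℕ; zero; suc; _≤_; z≤n; s≤s)
import Data.Nat.Properties as ℕ
open import Data.Rational using (½; positive) renaming (_≤_ to _≤ℚ_)
import Data.Rational.Properties as ℚ
open import Data.Rational.Solver using (module +-*-Solver)
open +-*-Solver using (solve; _:+_; _:*_; _:=_; con)
open import Data.Unit using (⊤; tt)
open import Data.Vec using ([]; _∷_; init; last)
open import Data.Vec.Relation.Binary.Pointwise.Inductive as VecPointwise using ([]; _∷_)
open import Data.Vec.Relation.Unary.All as VecAll using ([]; _∷_)
open import Relation.Binary.Bundles using (Setoid)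
open import Relation.Binary.PropositionalEquality as ≡ using (refl; cong; cong₂; sym; subst)
open import Relation.Nullary.Decidable using (from-yes)

module ℚ+ = CommutativeSemigroupProperties (CommutativeMonoid.commutativeSemigroup ℚ.+-0-commutativeMonoid)
module ℕ+ = CommutativeSemigroupProperties ℕ.+-commutativeSemigroup

mutual
  ≈A-refl : ∀ A → A ≈A A
  ≈A-refl (𝓜 ⇒ a) = ⇒-cong (≈M-refl 𝓜) (≈D-refl a)

  ≈M-refl : ∀ 𝓜 → 𝓜 ≈M 𝓜
  ≈M-refl []            = refl []
  ≈M-refl ((q , A) ∷ 𝓜) = prep (pairA refl (≈A-refl A)) (≈M-refl 𝓜)

  ≈D-refl : ∀ a → a ≈D a
  ≈D-refl []            = refl []
  ≈D-refl ((p , 𝓜) ∷ a) = prep (pairI refl (≈M-refl 𝓜)) (≈D-refl a)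

PairA-refl : ∀ {x} → PairA x x
PairA-refl {q , A} = pairA refl (≈A-refl A)

PairI-refl : ∀ {x} → PairI x x
PairI-refl {p , 𝓜} = pairI refl (≈M-refl 𝓜)

mutual
  ≈A-sym : ∀ {A B} → A ≈A B → B ≈A A
  ≈A-sym (⇒-cong 𝓜≈ a≈) = ⇒-cong (≈M-sym 𝓜≈) (≈D-sym a≈)

  PairA-sym : ∀ {x y} → PairA x y → PairA y x
  PairA-sym (pairA q≡ A≈) = pairA (sym q≡) (≈A-sym A≈)

  PairI-sym : ∀ {x y} → PairI x y → PairI y x
  PairI-sym (pairI p≡ 𝓜≈) = pairI (sym p≡) (≈M-sym 𝓜≈)

  ≈M-sym : ∀ {x y} → x ≈M y → y ≈M x
  ≈M-sym (refl xs≋ys)     = refl (PointwiseA-sym xs≋ys)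
  ≈M-sym (prep x≈ p)      = prep (PairA-sym x≈) (≈M-sym p)
  ≈M-sym (swap x≈ y≈ p)   = swap (PairA-sym y≈) (PairA-sym x≈) (≈M-sym p)
  ≈M-sym (trans p q)      = trans (≈M-sym q) (≈M-sym p)

  PointwiseA-sym : ∀ {x y} → Pointwise PairA x y → Pointwise PairA y x
  PointwiseA-sym []         = []
  PointwiseA-sym (x≈ ∷ xs≋) = PairA-sym x≈ ∷ PointwiseA-sym xs≋

  ≈D-sym : ∀ {x y} → x ≈D y → y ≈D x
  ≈D-sym (refl xs≋ys)     = refl (PointwiseI-sym xs≋ys)
  ≈D-sym (prep x≈ p)      = prep (PairI-sym x≈) (≈D-sym p)
  ≈D-sym (swap x≈ y≈ p)   = swap (PairI-sym y≈) (PairI-sym x≈) (≈D-sym p)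
  ≈D-sym (trans p q)      = trans (≈D-sym q) (≈D-sym p)

  PointwiseI-sym : ∀ {x y} → Pointwise PairI x y → Pointwise PairI y x
  PointwiseI-sym []         = []
  PointwiseI-sym (x≈ ∷ xs≋) = PairI-sym x≈ ∷ PointwiseI-sym xs≋

≈A-trans : ∀ {A B C} → A ≈A B → B ≈A C → A ≈A C
≈A-trans (⇒-cong 𝓜≈ a≈) (⇒-cong 𝓜≈′ a≈′) = ⇒-cong (trans 𝓜≈ 𝓜≈′) (trans a≈ a≈′)

PairA-trans : ∀ {x y z} → PairA x y → PairA y z → PairA x z
PairA-trans (pairA q≡ A≈) (pairA q≡′ A≈′) = pairA (≡.trans q≡ q≡′) (≈A-trans A≈ A≈′)

PairI-trans : ∀ {x y z} → PairI x y → PairI y z → PairI x z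
PairI-trans (pairI p≡ 𝓜≈) (pairI p≡′ 𝓜≈′) = pairI (≡.trans p≡ p≡′) (trans 𝓜≈ 𝓜≈′)

PairI-setoid : Setoid _ _
PairI-setoid = record
  { _≈_ = PairI
  ; isEquivalence = record { refl = PairI-refl ; sym = PairI-sym ; trans = PairI-trans }
  }

module ≈D = SetoidPermutation PairI-setoid

↭⇒Permutation : ∀ {A : Set} {R : A → A → Set} → (∀ {x} → R x x) →
                ∀ {xs ys} → xs ↭ ys → Permutation R xs ys
↭⇒Permutation R-refl ↭.refl        = refl (Pointwise.refl R-refl)
↭⇒Permutation R-refl (↭.prep x p)   = prep R-refl (↭⇒Permutation R-refl p)
↭⇒Permutation R-refl (↭.swap x y p) = swap R-refl R-refl (↭⇒Permutation R-refl p)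
↭⇒Permutation R-refl (↭.trans p q)  = trans (↭⇒Permutation R-refl p) (↭⇒Permutation R-refl q)

≈D-reflexive : ∀ {a b} → a ≡ b → a ≈D b
≈D-reflexive refl = ≈D-refl _

·D-cong : ∀ u {a b} → a ≈D b → (u ·D a) ≈D (u ·D b)
·D-cong u = ≈D.map⁺ PairI-setoid λ { (pairI p≡ 𝓜≈) → pairI (cong (u *_) p≡) 𝓜≈ }

-- A permutation up to R factors as a permutation of the list followed by pointwise R-steps,
-- so a derivation indexed by a multiset can first be reordered and then compared elementwise.
module PermutationFactorisation {A : Set} (R : A → A → Set) (R-trans : ∀ {x y z} → R x y → R y z → R x z) where

  Pointwise-↭-commute : ∀ {xs ys zs} → Pointwise R xs ys → ys ↭ zs →
                        Σ (List A) λ xs′ → xs ↭ xs′ × Pointwise R xs′ zs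
  Pointwise-↭-commute rs ↭.refl = _ , ↭.refl , rs
  Pointwise-↭-commute (r ∷ rs) (↭.prep _ p) with Pointwise-↭-commute rs p
  ... | _ , p′ , rs′ = _ , ↭.prep _ p′ , r ∷ rs′
  Pointwise-↭-commute (r₁ ∷ r₂ ∷ rs) (↭.swap _ _ p) with Pointwise-↭-commute rs p
  ... | _ , p′ , rs′ = _ , ↭.swap _ _ p′ , r₂ ∷ r₁ ∷ rs′
  Pointwise-↭-commute rs (↭.trans p q) with Pointwise-↭-commute rs p
  ... | _ , p′ , rs′ with Pointwise-↭-commute rs′ q
  ... | _ , q′ , rs″ = _ , ↭.trans p′ q′ , rs″

  factorise : ∀ {xs ys} → Permutation R xs ys → Σ (List A) λ zs → xs ↭ zs × Pointwise R zs ys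
  factorise (refl rs) = _ , ↭.refl , rs
  factorise (prep r p) with factorise p
  ... | _ , p′ , rs = _ , ↭.prep _ p′ , r ∷ rs
  factorise (swap r₁ r₂ p) with factorise p
  ... | _ , p′ , rs = _ , ↭.swap _ _ p′ , r₂ ∷ r₁ ∷ rs
  factorise (trans p q) with factorise p | factorise q
  ... | _ , p′ , rs | _ , q′ , rs′ with Pointwise-↭-commute rs q′
  ... | _ , q″ , rs″ = _ , ↭.trans p′ q″ , Pointwise.transitive R-trans rs″ rs′

  Pointwise-++⁻ : ∀ ys₁ {ys₂ xs} → Pointwise R xs (ys₁ ++ ys₂) →
                  Σ (List A) λ xs₁ → Σ (List A) λ xs₂ →
                    (xs ≡ xs₁ ++ xs₂) × Pointwise R xs₁ ys₁ × Pointwise R xs₂ ys₂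
  Pointwise-++⁻ []        rs       = [] , _ , refl , [] , rs
  Pointwise-++⁻ (_ ∷ ys₁) (r ∷ rs) with Pointwise-++⁻ ys₁ rs
  ... | xs₁ , xs₂ , refl , rs₁ , rs₂ = _ ∷ xs₁ , xs₂ , refl , r ∷ rs₁ , rs₂

open PermutationFactorisation PairA PairA-trans using () renaming (factorise to ≈M-factorise; Pointwise-++⁻ to PointwiseA-++⁻)
open PermutationFactorisation PairI PairI-trans using () renaming (factorise to ≈D-factorise)

≈M-[]-inv : ∀ {𝓜} → 𝓜 ≈M [] → 𝓜 ≡ []
≈M-[]-inv 𝓜≈[] with ≈M-factorise 𝓜≈[]
... | [] , p , [] = ↭.↭-empty-inv p

≈M-[-]-inv : ∀ {𝓜 y} → 𝓜 ≈M (y ∷ []) → Σ _ λ x → (𝓜 ≡ x ∷ []) × PairA x y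
≈M-[-]-inv 𝓜≈[y] with ≈M-factorise 𝓜≈[y]
... | x ∷ [] , p , (r ∷ []) = x , ↭.↭-singleton-inv p , r

_≈C_ : ∀ {n} → Ctx n → Ctx n → Set
_≈C_ = VecPointwise.Pointwise _↭_

≈C-refl : ∀ {n} {Γ : Ctx n} → Γ ≈C Γ
≈C-refl = VecPointwise.refl ↭.refl

≈C-reflexive : ∀ {n} {Γ Δ : Ctx n} → Γ ≡ Δ → Γ ≈C Δ
≈C-reflexive refl = ≈C-refl

≈C-trans : ∀ {n} {Γ Δ Θ : Ctx n} → Γ ≈C Δ → Δ ≈C Θ → Γ ≈C Θ
≈C-trans = VecPointwise.trans ↭.trans

⊎C-cong : ∀ {n} {Γ Γ′ Δ Δ′ : Ctx n} → Γ ≈C Γ′ → Δ ≈C Δ′ → (Γ ⊎C Δ) ≈C (Γ′ ⊎C Δ′)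
⊎C-cong = VecPointwise.zipWith-cong ↭.++⁺

·C-cong : ∀ {n} u {Γ Γ′ : Ctx n} → Γ ≈C Γ′ → (u ·C Γ) ≈C (u ·C Γ′)
·C-cong u = VecPointwise.map⁺ (↭.map⁺ _)

⊎C-shift : ∀ {n} (Γ Δ Θ : Ctx n) → (Γ ⊎C (Δ ⊎C Θ)) ≈C (Δ ⊎C (Γ ⊎C Θ))
⊎C-shift []      []      []      = []
⊎C-shift (𝓜 ∷ Γ) (𝓝 ∷ Δ) (𝓞 ∷ Θ) = ↭.shifts 𝓜 𝓝 ∷ ⊎C-shift Γ Δ Θ

-- The substituted variable is the outermost one, i.e. the last entry of a context.

init-⊎C : ∀ {j} (Γ Δ : Ctx (suc j)) → init (Γ ⊎C Δ) ≡ init Γ ⊎C init Δ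
init-⊎C {zero}  (_ ∷ []) (_ ∷ []) = refl
init-⊎C {suc j} (_ ∷ Γ)  (_ ∷ Δ)  = cong (_ ∷_) (init-⊎C Γ Δ)

last-⊎C : ∀ {j} (Γ Δ : Ctx (suc j)) → last (Γ ⊎C Δ) ≡ last Γ ++ last Δ
last-⊎C {zero}  (_ ∷ []) (_ ∷ []) = refl
last-⊎C {suc j} (_ ∷ Γ)  (_ ∷ Δ)  = last-⊎C Γ Δ

init-·C : ∀ {j} u (Γ : Ctx (suc j)) → init (u ·C Γ) ≡ u ·C init Γ
init-·C {zero}  u (_ ∷ []) = refl
init-·C {suc j} u (_ ∷ Γ)  = cong (_ ∷_) (init-·C u Γ)

last-·C : ∀ {j} u (Γ : Ctx (suc j)) → last (u ·C Γ) ≡ u ·M last Γ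
last-·C {zero}  u (_ ∷ []) = refl
last-·C {suc j} u (_ ∷ Γ)  = last-·C u Γ

init-∅ : ∀ {j} → init {n = j} ∅ ≡ ∅
init-∅ {zero}  = refl
init-∅ {suc j} = cong ([] ∷_) (init-∅ {j})

last-∅ : ∀ {j} → last {n = j} ∅ ≡ []
last-∅ {zero}  = refl
last-∅ {suc j} = last-∅ {j}

init-cong : ∀ {j} {Γ Δ : Ctx (suc j)} → Γ ≈C Δ → init Γ ≈C init Δ
init-cong {zero}  (_ ∷ [])  = []
init-cong {suc j} (p ∷ ps)  = p ∷ init-cong ps

last-cong : ∀ {j} {Γ Δ : Ctx (suc j)} → Γ ≈C Δ → last Γ ↭ last Δ
last-cong {zero}  (p ∷ [])  = p
last-cong {suc j} (_ ∷ ps)  = last-cong ps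

data LastOrInject : ∀ {j} → Fin (suc j) → Set where
  isLast   : ∀ {j} → LastOrInject (fromℕ j)
  isInject : ∀ {j} (y : Fin j) → LastOrInject (inject₁ y)

lastOrInject : ∀ {j} (x : Fin (suc j)) → LastOrInject x
lastOrInject {zero}  zero    = isLast
lastOrInject {suc j} zero    = isInject zero
lastOrInject {suc j} (suc x) with lastOrInject x
... | isLast     = isLast
... | isInject y = isInject (suc y)

init-[fromℕ∶] : ∀ {j} 𝓜 → init [ fromℕ j ∶ 𝓜 ] ≡ ∅
init-[fromℕ∶] {zero}  𝓜 = refl
init-[fromℕ∶] {suc j} 𝓜 = cong ([] ∷_) (init-[fromℕ∶] {j} 𝓜)

last-[fromℕ∶] : ∀ {j} 𝓜 → last [ fromℕ j ∶ 𝓜 ] ≡ 𝓜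
last-[fromℕ∶] {zero}  𝓜 = refl
last-[fromℕ∶] {suc j} 𝓜 = last-[fromℕ∶] {j} 𝓜

init-[inject₁∶] : ∀ {j} (y : Fin j) 𝓜 → init [ inject₁ y ∶ 𝓜 ] ≡ [ y ∶ 𝓜 ]
init-[inject₁∶] {suc j} zero    𝓜 = cong (𝓜 ∷_) (init-∅ {j})
init-[inject₁∶] {suc j} (suc y) 𝓜 = cong ([] ∷_) (init-[inject₁∶] y 𝓜)

last-[inject₁∶] : ∀ {j} (y : Fin j) 𝓜 → last [ inject₁ y ∶ 𝓜 ] ≡ []
last-[inject₁∶] {suc j} zero    𝓜 = last-∅ {j}
last-[inject₁∶] {suc j} (suc y) 𝓜 = last-[inject₁∶] y 𝓜

wkVar : ∀ j {n} → Fin (j ℕ.+ n) → Fin (j ℕ.+ suc n)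
wkVar zero    = suc
wkVar (suc j) = extR (wkVar j)

wkCtx : ∀ j {n} → Ctx (j ℕ.+ n) → Ctx (j ℕ.+ suc n)
wkCtx zero    Γ       = [] ∷ Γ
wkCtx (suc j) (𝓜 ∷ Γ) = 𝓜 ∷ wkCtx j Γ

wkCtx-⊎C : ∀ j {n} (Γ Δ : Ctx (j ℕ.+ n)) → wkCtx j (Γ ⊎C Δ) ≡ wkCtx j Γ ⊎C wkCtx j Δ
wkCtx-⊎C zero    Γ       Δ       = refl
wkCtx-⊎C (suc j) (_ ∷ Γ) (_ ∷ Δ) = cong (_ ∷_) (wkCtx-⊎C j Γ Δ)

wkCtx-·C : ∀ j {n} u (Γ : Ctx (j ℕ.+ n)) → wkCtx j (u ·C Γ) ≡ u ·C wkCtx j Γ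
wkCtx-·C zero    u Γ       = refl
wkCtx-·C (suc j) u (_ ∷ Γ) = cong (_ ∷_) (wkCtx-·C j u Γ)

wkCtx-·C⊎C : ∀ j {n} u (Γ Δ : Ctx (j ℕ.+ n)) → wkCtx j ((u ·C Γ) ⊎C Δ) ≡ (u ·C wkCtx j Γ) ⊎C wkCtx j Δ
wkCtx-·C⊎C j u Γ Δ = ≡.trans (wkCtx-⊎C j (u ·C Γ) Δ) (cong (_⊎C wkCtx j Δ) (wkCtx-·C j u Γ))

wkCtx-∅ : ∀ j {n} → wkCtx j {n} ∅ ≡ ∅
wkCtx-∅ zero    = refl
wkCtx-∅ (suc j) = cong ([] ∷_) (wkCtx-∅ j)

wkCtx-[∶] : ∀ j {n} (x : Fin (j ℕ.+ n)) 𝓜 → wkCtx j [ x ∶ 𝓜 ] ≡ [ wkVar j x ∶ 𝓜 ]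
wkCtx-[∶] zero    x       𝓜 = refl
wkCtx-[∶] (suc j) zero    𝓜 = cong (𝓜 ∷_) (wkCtx-∅ j)
wkCtx-[∶] (suc j) (suc x) 𝓜 = cong ([] ∷_) (wkCtx-[∶] j x 𝓜)

subst-size : ∀ {n} {F : Ctx n → Set} (size : ∀ {Γ} → F Γ → ℕ) {Γ Δ} (Γ≡Δ : Γ ≡ Δ) (D : F Γ) →
             size (subst F Γ≡Δ D) ≡ size D
subst-size size refl D = refl

module _ {n : ℕ} {Γ Δ : Ctx n} (Γ≡Δ : Γ ≡ Δ) where

  castT : ∀ {M w a} → DerT Γ M w a → DerT Δ M w a
  castT = subst (λ Γ → DerT Γ _ _ _) Γ≡Δ

  castM : ∀ {V w 𝓜} → DerM Γ V w 𝓜 → DerM Δ V w 𝓜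
  castM = subst (λ Γ → DerM Γ _ _ _) Γ≡Δ

  castBang : ∀ {V w 𝓜} → Bang Γ V w 𝓜 → Bang Δ V w 𝓜
  castBang = subst (λ Γ → Bang Γ _ _ _) Γ≡Δ

  castBranches : ∀ {M a w b} → Branches M a Γ w b → Branches M a Δ w b
  castBranches = subst (λ Γ → Branches _ _ Γ _ _) Γ≡Δ

  sizeT-castT : ∀ {M w a} (D : DerT Γ M w a) → sizeT (castT D) ≡ sizeT D
  sizeT-castT = subst-size sizeT Γ≡Δ

  sizeM-castM : ∀ {V w 𝓜} (D : DerM Γ V w 𝓜) → sizeM (castM D) ≡ sizeM D
  sizeM-castM = subst-size sizeM Γ≡Δ

  sizeB-castBang : ∀ {V w 𝓜} (B : Bang Γ V w 𝓜) → sizeB (castBang B) ≡ sizeB B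
  sizeB-castBang = subst-size sizeB Γ≡Δ

  sizeBr-castBranches : ∀ {M a w b} (Bs : Branches M a Γ w b) → sizeBr (castBranches Bs) ≡ sizeBr Bs
  sizeBr-castBranches = subst-size sizeBr Γ≡Δ

mutual
  wkDerT : ∀ j {n} {Γ : Ctx (j ℕ.+ n)} {M w a} → DerT Γ M w a → DerT (wkCtx j Γ) (renT (wkVar j) M) w a
  wkDerT j zero-rule = castT (sym (wkCtx-∅ j)) zero-rule
  wkDerT j (app-rule {Γ = Γ} {Δ = Δ} D E e) =
    castT (sym (wkCtx-⊎C j Γ Δ)) (app-rule (wkDerM j D) (wkDerM j E) e)
  wkDerT j (⊕-rule {Γ = Γ} {Δ = Δ} D E) =
    castT (sym (wk-½⊎½ j Γ Δ)) (⊕-rule (wkDerT j D) (wkDerT j E))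
  wkDerT j (let-rule {Γ = Γ} {Δ = Δ} D Bs) =
    castT (sym (wkCtx-⊎C j Γ Δ)) (let-rule (wkDerT j D) (wkBranches j Bs))
  wkDerT j (val-rule D) = val-rule (wkDerM j D)

  wkDerM : ∀ j {n} {Γ : Ctx (j ℕ.+ n)} {V w 𝓜} → DerM Γ V w 𝓜 → DerM (wkCtx j Γ) (renV (wkVar j) V) w 𝓜
  wkDerM j (var-rule x wf) = castM (sym (wkCtx-[∶] j x _)) (var-rule (wkVar j x) wf)
  wkDerM j (!-rule B)      = !-rule (wkBang j B)

  wkBang : ∀ j {n} {Γ : Ctx (j ℕ.+ n)} {V w 𝓜} → Bang Γ V w 𝓜 → Bang (wkCtx j Γ) (renV (wkVar j) V) w 𝓜
  wkBang j [] = castBang (sym (wkCtx-∅ j)) []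
  wkBang j (cons {Γ = Γ} {Δ = Δ} q q>0 q≤1 D B) =
    castBang (sym (wkCtx-·C⊎C j q Γ Δ)) (cons q q>0 q≤1 (wkDerA j D) (wkBang j B))

  wkDerA : ∀ j {n} {Γ : Ctx (j ℕ.+ n)} {V w A} → DerA Γ V w A → DerA (wkCtx j Γ) (renV (wkVar j) V) w A
  wkDerA j (λ-rule D) = λ-rule (wkDerT (suc j) D)

  wkBranches : ∀ j {n} {M a} {Δ : Ctx (j ℕ.+ n)} {w b} → Branches M a Δ w b →
               Branches (renT (wkVar (suc j)) M) a (wkCtx j Δ) w b
  wkBranches j [] = castBranches (sym (wkCtx-∅ j)) []
  wkBranches j (cons {p = p} {Δ = Δ} {Δs = Δs} D e Bs) =
    castBranches (sym (wkCtx-·C⊎C j p Δ Δs)) (cons (wkDerT (suc j) D) e (wkBranches j Bs))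

  wk-½⊎½ : ∀ j {n} (Γ Δ : Ctx (j ℕ.+ n)) → wkCtx j ((½ ·C Γ) ⊎C (½ ·C Δ)) ≡ (½ ·C wkCtx j Γ) ⊎C (½ ·C wkCtx j Δ)
  wk-½⊎½ j Γ Δ = ≡.trans (wkCtx-·C⊎C j ½ Γ (½ ·C Δ)) (cong (_ ⊎C_) (wkCtx-·C j ½ Δ))

mutual
  sizeT-wkDerT : ∀ j {n} {Γ : Ctx (j ℕ.+ n)} {M w a} (D : DerT Γ M w a) → sizeT (wkDerT j D) ≡ sizeT D
  sizeT-wkDerT j zero-rule = sizeT-castT (sym (wkCtx-∅ j)) zero-rule
  sizeT-wkDerT j (app-rule {Γ = Γ} {Δ = Δ} D E e) =
    ≡.trans (sizeT-castT (sym (wkCtx-⊎C j Γ Δ)) _) (cong suc (cong₂ ℕ._+_ (sizeM-wkDerM j D) (sizeM-wkDerM j E)))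
  sizeT-wkDerT j (⊕-rule {Γ = Γ} {Δ = Δ} D E) =
    ≡.trans (sizeT-castT (sym (wk-½⊎½ j Γ Δ)) _) (cong suc (cong₂ ℕ._+_ (sizeT-wkDerT j D) (sizeT-wkDerT j E)))
  sizeT-wkDerT j (let-rule {Γ = Γ} {Δ = Δ} D Bs) =
    ≡.trans (sizeT-castT (sym (wkCtx-⊎C j Γ Δ)) _) (cong suc (cong₂ ℕ._+_ (sizeT-wkDerT j D) (sizeBr-wkBranches j Bs)))
  sizeT-wkDerT j (val-rule D) = sizeM-wkDerM j D

  sizeM-wkDerM : ∀ j {n} {Γ : Ctx (j ℕ.+ n)} {V w 𝓜} (D : DerM Γ V w 𝓜) → sizeM (wkDerM j D) ≡ sizeM D
  sizeM-wkDerM j (var-rule x wf) = sizeM-castM (sym (wkCtx-[∶] j x _)) _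
  sizeM-wkDerM j (!-rule B)      = sizeB-wkBang j B

  sizeB-wkBang : ∀ j {n} {Γ : Ctx (j ℕ.+ n)} {V w 𝓜} (B : Bang Γ V w 𝓜) → sizeB (wkBang j B) ≡ sizeB B
  sizeB-wkBang j [] = sizeB-castBang (sym (wkCtx-∅ j)) []
  sizeB-wkBang j (cons {Γ = Γ} {Δ = Δ} q _ _ D B) =
    ≡.trans (sizeB-castBang (sym (wkCtx-·C⊎C j q Γ Δ)) _) (cong₂ ℕ._+_ (sizeA-wkDerA j D) (sizeB-wkBang j B))

  sizeA-wkDerA : ∀ j {n} {Γ : Ctx (j ℕ.+ n)} {V w A} (D : DerA Γ V w A) → sizeA (wkDerA j D) ≡ sizeA D
  sizeA-wkDerA j (λ-rule D) = cong suc (sizeT-wkDerT (suc j) D)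

  sizeBr-wkBranches : ∀ j {n} {M a} {Δ : Ctx (j ℕ.+ n)} {w b} (Bs : Branches M a Δ w b) →
                      sizeBr (wkBranches j Bs) ≡ sizeBr Bs
  sizeBr-wkBranches j [] = sizeBr-castBranches (sym (wkCtx-∅ j)) []
  sizeBr-wkBranches j (cons {p = p} {Δ = Δ} {Δs = Δs} D e Bs) =
    ≡.trans (sizeBr-castBranches (sym (wkCtx-·C⊎C j p Δ Δs)) _) (cong₂ ℕ._+_ (sizeT-wkDerT (suc j) D) (sizeBr-wkBranches j Bs))

-- This invariant is what allows a (!)-derivation split along a rescaled context q·Γ to be
-- rescaled back by 1/q.
Scale : ℚ → Set
Scale q = (0ℚ <ℚ q) × (q ≤ℚ 1ℚ)

Scales : ∀ {X : Set} → List (ℚ × X) → Set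
Scales = All (λ x → Scale (proj₁ x))

ScalesC : ∀ {n} → Ctx n → Set
ScalesC = VecAll.All Scales

TargetScales : AType → Set
TargetScales (𝓜 ⇒ b) = Scales b

TargetsScale : IType → Set
TargetsScale = All (λ x → TargetScales (proj₂ x))

Scale-* : ∀ {p q} → Scale p → Scale q → Scale (p * q)
Scale-* {p} {q} (p>0 , p≤1) (q>0 , q≤1) =
  ℚ.positive⁻¹ (p * q) {{ℚ.pos*pos⇒pos p {{positive p>0}} q {{positive q>0}}}} ,
  ℚ.≤-trans (ℚ.*-monoʳ-≤-nonNeg q {{ℚ.pos⇒nonNeg q {{positive q>0}}}} p≤1)
            (ℚ.≤-trans (ℚ.≤-reflexive (ℚ.*-identityˡ q)) q≤1)

Scale-½ : Scale ½
Scale-½ = from-yes (0ℚ ℚ.<? ½) , from-yes (½ ℚ.≤? 1ℚ)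

Scale-1 : Scale 1ℚ
Scale-1 = from-yes (0ℚ ℚ.<? 1ℚ) , ℚ.≤-refl

Scales-++ : ∀ {X : Set} {xs ys : List (ℚ × X)} → Scales xs → Scales ys → Scales (xs ++ ys)
Scales-++ []       s = s
Scales-++ (p ∷ ps) s = p ∷ Scales-++ ps s

Scales-· : ∀ {X : Set} {u} {xs : List (ℚ × X)} → Scale u → Scales xs →
           Scales (map (λ x → u * proj₁ x , proj₂ x) xs)
Scales-· u []       = []
Scales-· u (p ∷ ps) = Scale-* u p ∷ Scales-· u ps

ScalesC-∅ : ∀ {n} → ScalesC (∅ {n})
ScalesC-∅ {zero}  = []
ScalesC-∅ {suc n} = [] ∷ ScalesC-∅

ScalesC-⊎C : ∀ {n} {Γ Δ : Ctx n} → ScalesC Γ → ScalesC Δ → ScalesC (Γ ⊎C Δ)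
ScalesC-⊎C []       []       = []
ScalesC-⊎C (s ∷ ss) (t ∷ ts) = Scales-++ s t ∷ ScalesC-⊎C ss ts

ScalesC-·C : ∀ {n} {u} {Γ : Ctx n} → Scale u → ScalesC Γ → ScalesC (u ·C Γ)
ScalesC-·C u []       = []
ScalesC-·C u (s ∷ ss) = Scales-· u s ∷ ScalesC-·C u ss

ScalesC-[∶] : ∀ {n} (x : Fin n) {𝓜} → Scales 𝓜 → ScalesC [ x ∶ 𝓜 ]
ScalesC-[∶] zero    s = s ∷ ScalesC-∅
ScalesC-[∶] (suc x) s = [] ∷ ScalesC-[∶] x s

ScalesC-last : ∀ {j} {Γ : Ctx (suc j)} → ScalesC Γ → Scales (last Γ)
ScalesC-last {zero}  (s ∷ []) = s
ScalesC-last {suc j} (_ ∷ ss) = ScalesC-last ss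

WFM⇒scales : ∀ {𝓜} → WFM 𝓜 → Scales 𝓜 × TargetsScale 𝓜
WFM⇒scales [] = [] , []
WFM⇒scales ((q>0 , q≤1 , wf⇒ _ (wfD wf _)) ∷ wfs) =
  (q>0 , q≤1) ∷ proj₁ (WFM⇒scales wfs) , WFD′⇒scales wf ∷ proj₂ (WFM⇒scales wfs)
  where
    WFD′⇒scales : ∀ {a} → WFD′ a → Scales a
    WFD′⇒scales []                  = []
    WFD′⇒scales ((p>0 , p≤1 , _) ∷ wf) = (p>0 , p≤1) ∷ WFD′⇒scales wf

mutual
  DerT-scales : ∀ {n} {Γ : Ctx n} {M w a} → DerT Γ M w a → ScalesC Γ × Scales a
  DerT-scales zero-rule = ScalesC-∅ , []
  DerT-scales (app-rule D E _) with DerM-scales D | DerM-scales E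
  ... | sΓ , (sb ∷ []) | sΔ , _ = ScalesC-⊎C sΓ sΔ , sb
  DerT-scales (⊕-rule D E) with DerT-scales D | DerT-scales E
  ... | sΓ , sa | sΔ , sb =
    ScalesC-⊎C (ScalesC-·C Scale-½ sΓ) (ScalesC-·C Scale-½ sΔ) , Scales-++ (Scales-· Scale-½ sa) (Scales-· Scale-½ sb)
  DerT-scales (let-rule D Bs) with DerT-scales D
  ... | sΓ , sa with Branches-scales Bs sa
  ... | sΔ , sb = ScalesC-⊎C sΓ sΔ , sb
  DerT-scales (val-rule D) = proj₁ (DerM-scales D) , Scale-1 ∷ []

  DerM-scales : ∀ {n} {Γ : Ctx n} {V w 𝓜} → DerM Γ V w 𝓜 → ScalesC Γ × TargetsScale 𝓜
  DerM-scales (var-rule x wf) = ScalesC-[∶] x (proj₁ (WFM⇒scales wf)) , proj₂ (WFM⇒scales wf)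
  DerM-scales (!-rule B)      = Bang-scales B

  Bang-scales : ∀ {n} {Γ : Ctx n} {V w 𝓜} → Bang Γ V w 𝓜 → ScalesC Γ × TargetsScale 𝓜
  Bang-scales [] = ScalesC-∅ , []
  Bang-scales (cons q q>0 q≤1 D B) with DerA-scales D | Bang-scales B
  ... | sΓ , sA | sΔ , s𝓜 = ScalesC-⊎C (ScalesC-·C (q>0 , q≤1) sΓ) sΔ , sA ∷ s𝓜

  DerA-scales : ∀ {n} {Γ : Ctx n} {V w A} → DerA Γ V w A → ScalesC Γ × TargetScales A
  DerA-scales (λ-rule D) with DerT-scales D
  ... | (_ ∷ sΓ) , sb = sΓ , sb

  Branches-scales : ∀ {n} {M a} {Δ : Ctx n} {w b} → Branches M a Δ w b → Scales a → ScalesC Δ × Scales b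
  Branches-scales [] _ = ScalesC-∅ , []
  Branches-scales (cons D _ Bs) (sp ∷ sa) with DerT-scales D | Branches-scales Bs sa
  ... | (_ ∷ sΔ) , sb | sΔs , sbs = ScalesC-⊎C (ScalesC-·C sp sΔ) sΔs , Scales-++ (Scales-· sp sb) sbs

-- The premises are typed in the empty context, so the derivation can be weakened under binders
-- and split among the occurrences of a variable without any bookkeeping of contexts.
data ClosedBang {n} (V : Val n) : ℚ → IType → Set where
  []   : ClosedBang V 0ℚ []
  cons : ∀ {w v A 𝓜} q → Scale q → DerA ∅ V w A → ClosedBang V v 𝓜 →
         ClosedBang V (q * w + v) ((q , A) ∷ 𝓜)

sizeCB : ∀ {n} {V : Val n} {v 𝓜} → ClosedBang V v 𝓜 → ℕ
sizeCB []             = 0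
sizeCB (cons _ _ D B) = sizeA D ℕ.+ sizeCB B

q·C∅⊎C∅ : ∀ {n} q → (q ·C ∅) ⊎C ∅ ≡ ∅ {n}
q·C∅⊎C∅ {zero}  q = refl
q·C∅⊎C∅ {suc n} q = cong ([] ∷_) (q·C∅⊎C∅ q)

toBang : ∀ {n} {V : Val n} {v 𝓜} → ClosedBang V v 𝓜 → Bang ∅ V v 𝓜
toBang []                         = []
toBang (cons q (q>0 , q≤1) D B) = castBang (q·C∅⊎C∅ q) (cons q q>0 q≤1 D (toBang B))

sizeB-toBang : ∀ {n} {V : Val n} {v 𝓜} (B : ClosedBang V v 𝓜) → sizeB (toBang B) ≡ sizeCB B
sizeB-toBang []                       = refl
sizeB-toBang (cons q (q>0 , q≤1) D B) =
  ≡.trans (sizeB-castBang (q·C∅⊎C∅ q) (cons q q>0 q≤1 D (toBang B))) (cong (sizeA D ℕ.+_) (sizeB-toBang B))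

fromBang : ∀ {Γ : Ctx 0} {V v 𝓜} → Bang Γ V v 𝓜 → ClosedBang V v 𝓜
fromBang []                          = []
fromBang (cons {Γ = []} q q>0 q≤1 D B) = cons q (q>0 , q≤1) D (fromBang B)

sizeCB-fromBang : ∀ {Γ : Ctx 0} {V v 𝓜} (B : Bang Γ V v 𝓜) → sizeCB (fromBang B) ≡ sizeB B
sizeCB-fromBang []                          = refl
sizeCB-fromBang (cons {Γ = []} q q>0 q≤1 D B) = cong (sizeA D ℕ.+_) (sizeCB-fromBang B)

wkClosedBang : ∀ {n} {V : Val n} {v 𝓜} → ClosedBang V v 𝓜 → ClosedBang (renV suc V) v 𝓜
wkClosedBang []             = []
wkClosedBang (cons q s D B) = cons q s (wkDerA zero D) (wkClosedBang B)

sizeCB-wkClosedBang : ∀ {n} {V : Val n} {v 𝓜} (B : ClosedBang V v 𝓜) → sizeCB (wkClosedBang B) ≡ sizeCB B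
sizeCB-wkClosedBang []             = refl
sizeCB-wkClosedBang (cons q s D B) = cong₂ ℕ._+_ (sizeA-wkDerA zero D) (sizeCB-wkClosedBang B)

ClosedBang-empty : ∀ {n} {V : Val n} {v 𝓜} → ClosedBang V v 𝓜 → 𝓜 ≈M [] → v ≡ 0ℚ
ClosedBang-empty B 𝓜≈[] with ≈M-[]-inv 𝓜≈[]
ClosedBang-empty [] _ | refl = refl

record Permuted {n} (V : Val n) (v : ℚ) (𝓜 : IType) (s : ℕ) : Set where
  constructor permuted
  field
    {v′}   : ℚ
    bang   : ClosedBang V v′ 𝓜
    weight : v′ ≡ v
    size   : sizeCB bang ≡ s

ClosedBang-permute : ∀ {n} {V : Val n} {v 𝓜 𝓝} (B : ClosedBang V v 𝓜) → 𝓜 ↭ 𝓝 → Permuted V v 𝓝 (sizeCB B)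
ClosedBang-permute B ↭.refl = permuted B refl refl
ClosedBang-permute (cons q s D B) (↭.prep _ p) with ClosedBang-permute B p
... | permuted B′ refl size = permuted (cons q s D B′) refl (cong (sizeA D ℕ.+_) size)
ClosedBang-permute (cons {w = w} q s D (cons {w = w′} q′ s′ D′ B)) (↭.swap _ _ p) with ClosedBang-permute B p
... | permuted {v′} B′ refl size =
  permuted (cons q′ s′ D′ (cons q s D B′)) (ℚ+.x∙yz≈y∙xz (q′ * w′) (q * w) v′)
    (≡.trans (cong (λ t → sizeA D′ ℕ.+ (sizeA D ℕ.+ t)) size) (ℕ+.x∙yz≈y∙xz (sizeA D′) (sizeA D) (sizeCB B)))
ClosedBang-permute B (↭.trans p q) with ClosedBang-permute B p
... | permuted B′ refl size with ClosedBang-permute B′ q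
... | permuted B″ refl size′ = permuted B″ refl (≡.trans size′ size)

record Split {n} (V : Val n) (v : ℚ) (𝓜₁ 𝓜₂ : IType) (s : ℕ) : Set where
  constructor split
  field
    {𝓝₁ 𝓝₂} : IType
    {v₁ v₂} : ℚ
    bang₁   : ClosedBang V v₁ 𝓝₁
    bang₂   : ClosedBang V v₂ 𝓝₂
    type₁   : 𝓝₁ ≈M 𝓜₁
    type₂   : 𝓝₂ ≈M 𝓜₂
    weight  : v ≡ v₁ + v₂
    size    : s ≡ sizeCB bang₁ ℕ.+ sizeCB bang₂

ClosedBang-split-++ : ∀ {n} {V : Val n} {v} 𝓜₁ {𝓜₂} (B : ClosedBang V v (𝓜₁ ++ 𝓜₂)) → Split V v 𝓜₁ 𝓜₂ (sizeCB B)
ClosedBang-split-++ [] B = split [] B (≈M-refl []) (≈M-refl _) (sym (ℚ.+-identityˡ _)) refl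
ClosedBang-split-++ (_ ∷ 𝓜₁) (cons {w = w} q s D B) with ClosedBang-split-++ 𝓜₁ B
... | split {v₁ = v₁} {v₂} B₁ B₂ type₁ type₂ refl size =
  split (cons q s D B₁) B₂ (prep PairA-refl type₁) type₂ (sym (ℚ.+-assoc (q * w) v₁ v₂))
    (≡.trans (cong (sizeA D ℕ.+_) size) (sym (ℕ.+-assoc (sizeA D) (sizeCB B₁) (sizeCB B₂))))

ClosedBang-split : ∀ {n} {V : Val n} {v 𝓝} 𝓜₁ {𝓜₂} (B : ClosedBang V v 𝓝) → 𝓝 ≈M (𝓜₁ ++ 𝓜₂) →
                   Split V v 𝓜₁ 𝓜₂ (sizeCB B)
ClosedBang-split 𝓜₁ B 𝓝≈ with ≈M-factorise 𝓝≈
... | _ , p , ≋ with PointwiseA-++⁻ 𝓜₁ ≋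
... | 𝓝₁ , _ , refl , ≋₁ , ≋₂ with ClosedBang-permute B p
... | permuted B′ refl size with ClosedBang-split-++ 𝓝₁ B′
... | split B₁ B₂ type₁ type₂ weight size′ =
  split B₁ B₂ (trans type₁ (refl ≋₁)) (trans type₂ (refl ≋₂)) weight (≡.trans (sym size) size′)

record Unscaled {n} (V : Val n) (u v : ℚ) (𝓜 : IType) (s : ℕ) : Set where
  constructor unscaled
  field
    {𝓝}    : IType
    {v′}   : ℚ
    bang   : ClosedBang V v′ 𝓝
    type   : 𝓝 ≈M 𝓜
    weight : v ≡ u * v′
    size   : sizeCB bang ≡ s

ClosedBang-unscale-≋ : ∀ {n} {V : Val n} {v} u 𝓜 {𝓝} (B : ClosedBang V v 𝓝) → Pointwise PairA 𝓝 (u ·M 𝓜) →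
                       Scales 𝓜 → Unscaled V u v 𝓜 (sizeCB B)
ClosedBang-unscale-≋ u [] [] [] [] = unscaled [] (≈M-refl []) (sym (ℚ.*-zeroʳ u)) refl
ClosedBang-unscale-≋ u ((q , _) ∷ 𝓜) (cons {w = w} _ _ D B) (pairA refl A≈ ∷ ≋) (s ∷ ss)
  with ClosedBang-unscale-≋ u 𝓜 B ≋ ss
... | unscaled {v′ = v′} B′ type refl size =
  unscaled (cons q s D B′) (prep (pairA refl A≈) type)
    (≡.trans (cong (_+ u * v′) (ℚ.*-assoc u q w)) (sym (ℚ.*-distribˡ-+ u (q * w) v′)))
    (cong (sizeA D ℕ.+_) size)

ClosedBang-unscale : ∀ {n} {V : Val n} {v 𝓝} u {𝓜} (B : ClosedBang V v 𝓝) → 𝓝 ≈M (u ·M 𝓜) → Scales 𝓜 →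
                     Unscaled V u v 𝓜 (sizeCB B)
ClosedBang-unscale u {𝓜} B 𝓝≈ ss with ≈M-factorise 𝓝≈
... | _ , p , ≋ with ClosedBang-permute B p
... | permuted B′ refl size with ClosedBang-unscale-≋ u 𝓜 B′ ≋ ss
... | unscaled B″ type weight size′ = unscaled B″ type weight (≡.trans size′ size)

record Realigned {n} (M : Term (suc n)) (a : TDist) (Δ : Ctx n) (ws : ℚ) (bs : TDist) (s : ℕ) : Set where
  constructor realigned
  field
    {Δ′}     : Ctx n
    {ws′}    : ℚ
    {bs′}    : TDist
    branches : Branches M a Δ′ ws′ bs′
    context  : Δ′ ≈C Δ
    type     : bs′ ≈D bs
    weight   : ws′ ≡ ws
    size     : sizeBr branches ≡ s

Branches-≋ : ∀ {n} {M : Term (suc n)} {a a′ Δ ws bs} (Bs : Branches M a Δ ws bs) → Pointwise PairI a′ a →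
             Σ (Branches M a′ Δ ws bs) λ Bs′ → sizeBr Bs′ ≡ sizeBr Bs
Branches-≋ []             []                    = [] , refl
Branches-≋ (cons D 𝓜≈ Bs) (pairI refl 𝓜′≈ ∷ ≋) with Branches-≋ Bs ≋
... | Bs′ , size = cons D (trans 𝓜≈ (≈M-sym 𝓜′≈)) Bs′ , cong (sizeT D ℕ.+_) size

Branches-permute : ∀ {n} {M : Term (suc n)} {a a′ Δ ws bs} (Bs : Branches M a Δ ws bs) → a ↭ a′ →
                   Realigned M a′ Δ ws bs (sizeBr Bs)
Branches-permute Bs ↭.refl = realigned Bs ≈C-refl (≈D-refl _) refl refl
Branches-permute (cons {p = p} {b = b} D 𝓜≈ Bs) (↭.prep _ π) with Branches-permute Bs π
... | realigned Bs′ context type refl size =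
  realigned (cons D 𝓜≈ Bs′) (⊎C-cong ≈C-refl context) (≈D.++⁺ˡ (p ·D b) type) refl (cong (sizeT D ℕ.+_) size)
Branches-permute (cons {p = p₁} {Δ = Δ₁} {w = w₁} {b = b₁} D₁ 𝓜≈₁ (cons {p = p₂} {Δ = Δ₂} {w = w₂} {b = b₂} D₂ 𝓜≈₂ Bs))
                 (↭.swap _ _ π) with Branches-permute Bs π
... | realigned {ws′ = ws′} Bs′ context type refl size =
  realigned (cons D₂ 𝓜≈₂ (cons D₁ 𝓜≈₁ Bs′))
    (≈C-trans (⊎C-cong ≈C-refl (⊎C-cong ≈C-refl context)) (⊎C-shift (p₂ ·C Δ₂) (p₁ ·C Δ₁) _))
    (trans (≈D.++⁺ˡ (p₂ ·D b₂) (≈D.++⁺ˡ (p₁ ·D b₁) type)) (≈D.shifts (p₂ ·D b₂) (p₁ ·D b₁)))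
    (ℚ+.x∙yz≈y∙xz (p₂ * w₂) (p₁ * w₁) ws′)
    (≡.trans (cong (λ t → sizeT D₂ ℕ.+ (sizeT D₁ ℕ.+ t)) size) (ℕ+.x∙yz≈y∙xz (sizeT D₂) (sizeT D₁) (sizeBr Bs)))
Branches-permute Bs (↭.trans π π′) with Branches-permute Bs π
... | realigned Bs′ context type refl size with Branches-permute Bs′ π′
... | realigned Bs″ context′ type′ refl size′ =
  realigned Bs″ (≈C-trans context′ context) (trans type′ type) refl (≡.trans size′ size)

Branches-realign : ∀ {n} {M : Term (suc n)} {a a′ Δ ws bs} (Bs : Branches M a Δ ws bs) → a′ ≈D a →
                   Realigned M a′ Δ ws bs (sizeBr Bs)
Branches-realign Bs a′≈a with ≈D-factorise a′≈a
... | _ , π , ≋ with Branches-≋ Bs ≋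
... | Bs₁ , size with Branches-permute Bs₁ (↭.↭-sym π)
... | realigned Bs′ context type weight size′ = realigned Bs′ context type weight (≡.trans size′ size)

init-·C⊎C : ∀ {j} u (Γ Δ : Ctx (suc j)) → init ((u ·C Γ) ⊎C Δ) ≡ (u ·C init Γ) ⊎C init Δ
init-·C⊎C u Γ Δ = ≡.trans (init-⊎C (u ·C Γ) Δ) (cong (_⊎C init Δ) (init-·C u Γ))

last-·C⊎C : ∀ {j} u (Γ Δ : Ctx (suc j)) → last ((u ·C Γ) ⊎C Δ) ≡ (u ·M last Γ) ++ last Δ
last-·C⊎C u Γ Δ = ≡.trans (last-⊎C (u ·C Γ) Δ) (cong (_++ last Δ) (last-·C u Γ))

init-½⊎½ : ∀ {j} (Γ Δ : Ctx (suc j)) → init ((½ ·C Γ) ⊎C (½ ·C Δ)) ≡ (½ ·C init Γ) ⊎C (½ ·C init Δ)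
init-½⊎½ Γ Δ = ≡.trans (init-·C⊎C ½ Γ (½ ·C Δ)) (cong (_ ⊎C_) (init-·C ½ Δ))

last-½⊎½ : ∀ {j} (Γ Δ : Ctx (suc j)) → last ((½ ·C Γ) ⊎C (½ ·C Δ)) ≡ (½ ·M last Γ) ++ (½ ·M last Δ)
last-½⊎½ Γ Δ = ≡.trans (last-·C⊎C ½ Γ (½ ·C Δ)) (cong (_ ++_) (last-·C ½ Δ))

+-mono-≤-interchange : ∀ {a′ b′ s} a b x y → a′ ≤ a ℕ.+ x → b′ ≤ b ℕ.+ y → s ≡ x ℕ.+ y → a′ ℕ.+ b′ ≤ (a ℕ.+ b) ℕ.+ s
+-mono-≤-interchange a b x y a′≤ b′≤ refl = ℕ.≤-trans (ℕ.+-mono-≤ a′≤ b′≤) (ℕ.≤-reflexive (ℕ+.interchange a x b y))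

scaled-weight : ∀ q w u a b → q * (w + a) + (u + b) ≡ (q * w + u) + (q * a + b)
scaled-weight q w u a b = ≡.trans (cong (_+ (u + b)) (ℚ.*-distribˡ-+ q w a)) (ℚ+.interchange (q * w) (q * a) u b)

⊕-weight : ∀ w u a b → ½ * (w + a) + ½ * (u + b) + 1ℚ ≡ (½ * w + ½ * u + 1ℚ) + (½ * a + ½ * b)
⊕-weight = solve 4 (λ w u a b → con ½ :* (w :+ a) :+ con ½ :* (u :+ b) :+ con 1ℚ
                                 := (con ½ :* w :+ con ½ :* u :+ con 1ℚ) :+ (con ½ :* a :+ con ½ :* b)) refl

let-weight : ∀ ws u a b → (ws + b) + (u + a) + 1ℚ ≡ (ws + u + 1ℚ) + (a + b)
let-weight = solve 4 (λ ws u a b → (ws :+ b) :+ (u :+ a) :+ con 1ℚ := (ws :+ u :+ con 1ℚ) :+ (a :+ b)) refl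

module Substitution (V₀ : Val 0) where

  -- σ j substitutes V₀ for the outermost variable of a term under j further binders.
  σ : (j : ℕ) → Fin (suc j) → Val j
  σ zero    = single V₀
  σ (suc j) = extS (σ j)

  V₀↑ : (j : ℕ) → Val j
  V₀↑ j = σ j (fromℕ j)

  σ-inject₁ : ∀ j (y : Fin j) → σ j (inject₁ y) ≡ var y
  σ-inject₁ (suc j) zero    = refl
  σ-inject₁ (suc j) (suc y) = cong (renV suc) (σ-inject₁ j y)

  record Substituted {j} {T : Set} (_≈_ : T → T → Set) (Der : Ctx j → ℚ → T → Set)
                     (size : ∀ {Γ w t} → Der Γ w t → ℕ) (Θ : Ctx (suc j)) (w : ℚ) (t : T) (s : ℕ) : Set where
    constructor substituted
    field
      {Γ′}       : Ctx j
      {w′}       : ℚ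
      {t′}       : T
      derivation : Der Γ′ w′ t′
      context    : Γ′ ≈C init Θ
      type       : t′ ≈ t
      weight     : w′ ≡ w
      size≤      : size derivation ≤ s

  SubstitutedT : ∀ j → Ctx (suc j) → Term (suc j) → ℚ → TDist → ℕ → Set
  SubstitutedT j Θ M = Substituted _≈D_ (λ Γ → DerT Γ (subT (σ j) M)) sizeT Θ

  SubstitutedM : ∀ j → Ctx (suc j) → Val (suc j) → ℚ → IType → ℕ → Set
  SubstitutedM j Θ V = Substituted _≈M_ (λ Γ → DerM Γ (subV (σ j) V)) sizeM Θ

  SubstitutedBang : ∀ j → Ctx (suc j) → Val (suc j) → ℚ → IType → ℕ → Set
  SubstitutedBang j Θ V = Substituted _≈M_ (λ Γ → Bang Γ (subV (σ j) V)) sizeB Θ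

  SubstitutedA : ∀ j → Ctx (suc j) → Val (suc j) → ℚ → AType → ℕ → Set
  SubstitutedA j Θ V = Substituted _≈A_ (λ Γ → DerA Γ (subV (σ j) V)) sizeA Θ

  SubstitutedBranches : ∀ j → Term (suc (suc j)) → TDist → Ctx (suc j) → ℚ → TDist → ℕ → Set
  SubstitutedBranches j M a = Substituted _≈D_ (Branches (subT (extS (σ j)) M) a) sizeBr

  mutual
    substDerT : ∀ {j} {Θ : Ctx (suc j)} {M w a} (Π : DerT Θ M w a) {v 𝓝} (B : ClosedBang (V₀↑ j) v 𝓝) →
                𝓝 ≈M last Θ → SubstitutedT j Θ M (w + v) a (sizeT Π ℕ.+ sizeCB B)
    substDerT {j} zero-rule B 𝓝≈ with ClosedBang-empty B (subst (_ ≈M_) (last-∅ {j}) 𝓝≈)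
    ... | refl = substituted zero-rule (≈C-reflexive (sym (init-∅ {j}))) (≈D-refl []) (sym (ℚ.+-identityʳ 0ℚ)) (s≤s z≤n)
    substDerT (app-rule {Γ = Γ} {Δ = Δ} {w = w} {v = u} D E 𝓜≈) B 𝓝≈
      with ClosedBang-split (last Γ) B (subst (_ ≈M_) (last-⊎C Γ Δ) 𝓝≈)
    ... | split {v₁ = a} {b} B₁ B₂ type₁ type₂ refl size
      with substDerM D B₁ type₁ | substDerM E B₂ type₂
    ... | substituted D′ contextD typeD refl sizeD | substituted E′ contextE typeE refl sizeE
      with ≈M-[-]-inv typeD
    ... | _ , refl , pairA refl (⇒-cong 𝓜′≈ b′≈) =
      substituted (app-rule D′ E′ (trans 𝓜′≈ (trans 𝓜≈ (≈M-sym typeE))))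
        (≈C-trans (⊎C-cong contextD contextE) (≈C-reflexive (sym (init-⊎C Γ Δ))))
        b′≈ (ℚ+.interchange w a u b)
        (s≤s (+-mono-≤-interchange (sizeM D) (sizeM E) (sizeCB B₁) (sizeCB B₂) sizeD sizeE size))
    substDerT (⊕-rule {Γ = Γ} {Δ = Δ} {w = w} {v = u} D E) B 𝓝≈
      with ClosedBang-split (½ ·M last Γ) B (subst (_ ≈M_) (last-½⊎½ Γ Δ) 𝓝≈)
    ... | split B₁ B₂ type₁ type₂ refl size
      with ClosedBang-unscale ½ B₁ type₁ (ScalesC-last (proj₁ (DerT-scales D)))
         | ClosedBang-unscale ½ B₂ type₂ (ScalesC-last (proj₁ (DerT-scales E)))
    ... | unscaled {v′ = a} B₁′ type₁′ refl size₁ | unscaled {v′ = b} B₂′ type₂′ refl size₂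
      with substDerT D B₁′ type₁′ | substDerT E B₂′ type₂′
    ... | substituted D′ contextD typeD refl sizeD | substituted E′ contextE typeE refl sizeE =
      substituted (⊕-rule D′ E′)
        (≈C-trans (⊎C-cong (·C-cong ½ contextD) (·C-cong ½ contextE)) (≈C-reflexive (sym (init-½⊎½ Γ Δ))))
        (≈D.++⁺ (·D-cong ½ typeD) (·D-cong ½ typeE))
        (⊕-weight w u a b)
        (s≤s (+-mono-≤-interchange (sizeT D) (sizeT E) (sizeCB B₁′) (sizeCB B₂′) sizeD sizeE
                (≡.trans size (cong₂ ℕ._+_ (sym size₁) (sym size₂)))))
    substDerT (let-rule {Γ = Γ} {Δ = Δ} {v = u} {ws = ws} D Bs) B 𝓝≈
      with ClosedBang-split (last Γ) B (subst (_ ≈M_) (last-⊎C Γ Δ) 𝓝≈)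
    ... | split {v₁ = a} {b} B₁ B₂ type₁ type₂ refl size with substDerT D B₁ type₁
    ... | substituted D′ contextD typeD refl sizeD with Branches-realign Bs typeD
    ... | realigned Bs′ contextBs typeBs refl sizeBs
      with substBranches Bs′ B₂ (trans type₂ (↭⇒Permutation PairA-refl (↭.↭-sym (last-cong contextBs))))
    ... | substituted Bs″ contextBs″ typeBs″ refl sizeBs″ =
      substituted (let-rule D′ Bs″)
        (≈C-trans (⊎C-cong contextD (≈C-trans contextBs″ (init-cong contextBs))) (≈C-reflexive (sym (init-⊎C Γ Δ))))
        (trans typeBs″ typeBs)
        (let-weight ws u a b)
        (s≤s (+-mono-≤-interchange (sizeT D) (sizeBr Bs) (sizeCB B₁) (sizeCB B₂) sizeD
                (subst (λ t → sizeBr Bs″ ≤ t ℕ.+ sizeCB B₂) sizeBs sizeBs″) size))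
    substDerT (val-rule D) B 𝓝≈ with substDerM D B 𝓝≈
    ... | substituted D′ context type weight size = substituted (val-rule D′) context (prep (pairI refl type) (refl [])) weight size

    substDerM : ∀ {j} {Θ : Ctx (suc j)} {V w 𝓜} (Π : DerM Θ V w 𝓜) {v 𝓝} (B : ClosedBang (V₀↑ j) v 𝓝) →
                𝓝 ≈M last Θ → SubstitutedM j Θ V (w + v) 𝓜 (sizeM Π ℕ.+ sizeCB B)
    substDerM {j} (var-rule {𝓜 = 𝓜} x wf) B 𝓝≈ with lastOrInject x
    ... | isLast =
      substituted (!-rule (toBang B)) (≈C-reflexive (sym (init-[fromℕ∶] {j} 𝓜))) (subst (_ ≈M_) (last-[fromℕ∶] {j} 𝓜) 𝓝≈)
        (sym (ℚ.+-identityˡ _)) (ℕ.≤-trans (ℕ.≤-reflexive (sizeB-toBang B)) (ℕ.n≤1+n _))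
    ... | isInject y with ClosedBang-empty B (subst (_ ≈M_) (last-[inject₁∶] y 𝓜) 𝓝≈) | σ j (inject₁ y) | σ-inject₁ j y
    ... | refl | _ | refl =
      substituted (var-rule y wf) (≈C-reflexive (sym (init-[inject₁∶] y 𝓜))) (≈M-refl 𝓜) (sym (ℚ.+-identityʳ 0ℚ)) (s≤s z≤n)
    substDerM (!-rule Bg) B 𝓝≈ with substBang Bg B 𝓝≈
    ... | substituted Bg′ context type weight size = substituted (!-rule Bg′) context type weight size

    substBang : ∀ {j} {Θ : Ctx (suc j)} {V w 𝓜} (Π : Bang Θ V w 𝓜) {v 𝓝} (B : ClosedBang (V₀↑ j) v 𝓝) →
                𝓝 ≈M last Θ → SubstitutedBang j Θ V (w + v) 𝓜 (sizeB Π ℕ.+ sizeCB B)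
    substBang {j} [] B 𝓝≈ with ClosedBang-empty B (subst (_ ≈M_) (last-∅ {j}) 𝓝≈)
    ... | refl = substituted [] (≈C-reflexive (sym (init-∅ {j}))) (≈M-refl []) (sym (ℚ.+-identityʳ 0ℚ)) z≤n
    substBang (cons {Γ = Γ} {Δ = Δ} {w = w} {v = u} q q>0 q≤1 D Bg) B 𝓝≈
      with ClosedBang-split (q ·M last Γ) B (subst (_ ≈M_) (last-·C⊎C q Γ Δ) 𝓝≈)
    ... | split {v₂ = b} B₁ B₂ type₁ type₂ refl size
      with ClosedBang-unscale q B₁ type₁ (ScalesC-last (proj₁ (DerA-scales D)))
    ... | unscaled {v′ = a} B₁′ type₁′ refl size₁ with substDerA D B₁′ type₁′ | substBang Bg B₂ type₂
    ... | substituted D′ contextD typeD refl sizeD | substituted Bg′ contextBg typeBg refl sizeBg =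
      substituted (cons q q>0 q≤1 D′ Bg′)
        (≈C-trans (⊎C-cong (·C-cong q contextD) contextBg) (≈C-reflexive (sym (init-·C⊎C q Γ Δ))))
        (prep (pairA refl typeD) typeBg)
        (scaled-weight q w u a b)
        (+-mono-≤-interchange (sizeA D) (sizeB Bg) (sizeCB B₁′) (sizeCB B₂) sizeD sizeBg
           (≡.trans size (cong (ℕ._+ sizeCB B₂) (sym size₁))))

    substDerA : ∀ {j} {Θ : Ctx (suc j)} {V w A} (Π : DerA Θ V w A) {v 𝓝} (B : ClosedBang (V₀↑ j) v 𝓝) →
                𝓝 ≈M last Θ → SubstitutedA j Θ V (w + v) A (sizeA Π ℕ.+ sizeCB B)
    substDerA (λ-rule {w = w} D) {v} B 𝓝≈ with substDerT D (wkClosedBang B) 𝓝≈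
    ... | substituted D′ (𝓜′↭ ∷ context) type refl size =
      substituted (λ-rule D′) context (⇒-cong (↭⇒Permutation PairA-refl 𝓜′↭) type) (ℚ+.xy∙z≈xz∙y w v 1ℚ)
        (s≤s (subst (λ t → sizeT D′ ≤ sizeT D ℕ.+ t) (sizeCB-wkClosedBang B) size))

    substBranches : ∀ {j} {Δ : Ctx (suc j)} {M a ws bs} (Bs : Branches M a Δ ws bs) {v 𝓝} (B : ClosedBang (V₀↑ j) v 𝓝) →
                    𝓝 ≈M last Δ → SubstitutedBranches j M a Δ (ws + v) bs (sizeBr Bs ℕ.+ sizeCB B)
    substBranches {j} [] B 𝓝≈ with ClosedBang-empty B (subst (_ ≈M_) (last-∅ {j}) 𝓝≈)
    ... | refl = substituted [] (≈C-reflexive (sym (init-∅ {j}))) (≈D-refl []) (sym (ℚ.+-identityʳ 0ℚ)) z≤n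
    substBranches (cons {p = p} {Δ = Δ} {w = w} {Δs = Δs} {ws = ws} D 𝓜≈ Bs) B 𝓝≈
      with ClosedBang-split (p ·M last Δ) B (subst (_ ≈M_) (last-·C⊎C p Δ Δs) 𝓝≈)
    ... | split {v₂ = b} B₁ B₂ type₁ type₂ refl size
      with ClosedBang-unscale p B₁ type₁ (ScalesC-last (VecAll.tail (proj₁ (DerT-scales D))))
    ... | unscaled {v′ = a} B₁′ type₁′ refl size₁ with substDerT D (wkClosedBang B₁′) type₁′ | substBranches Bs B₂ type₂
    ... | substituted D′ (𝓜′↭ ∷ contextD) typeD refl sizeD | substituted Bs′ contextBs typeBs refl sizeBs =
      substituted (cons D′ (trans (↭⇒Permutation PairA-refl 𝓜′↭) 𝓜≈) Bs′)
        (≈C-trans (⊎C-cong (·C-cong p contextD) contextBs) (≈C-reflexive (sym (init-·C⊎C p Δ Δs))))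
        (≈D.++⁺ (·D-cong p typeD) typeBs)
        (scaled-weight p w ws a b)
        (+-mono-≤-interchange (sizeT D) (sizeBr Bs) (sizeCB B₁′) (sizeCB B₂)
           (subst (λ t → sizeT D′ ≤ sizeT D ℕ.+ t) (sizeCB-wkClosedBang B₁′) sizeD) sizeBs
           (≡.trans size (cong (ℕ._+ sizeCB B₂) (sym size₁))))

substitution-lemma : ∀ {𝓜 𝓝} {M : Term 1} {V : Val 0} {w v a} {Γ : Ctx 0} →
                     (ΠM : DerT (𝓜 ∷ []) M w a) (ΠV : Bang Γ V v 𝓝) → 𝓝 ≈M 𝓜 →
                     Σ ℚ λ w′ → Σ TDist λ a′ → Σ (DerT ∅ (M [ V /0]) w′ a′) λ Π →
                       (a′ ≈D a) × (w′ ≡ w + v) × (sizeT Π ≤ sizeT ΠM ℕ.+ sizeB ΠV)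
substitution-lemma {V = V} ΠM ΠV 𝓝≈𝓜 with Substitution.substDerT V ΠM (fromBang ΠV) 𝓝≈𝓜
... | Substitution.substituted Π [] type weight size =
  _ , _ , Π , type , weight , subst (λ t → sizeT Π ≤ sizeT ΠM ℕ.+ t) (sizeCB-fromBang ΠV) size

data SmallerDerivations (s : ℕ) : MDist 0 → TDist → ℚ → Set where
  []   : SmallerDerivations s [] [] 0ℚ
  cons : ∀ {q P ds b w bᵢ wᵢ} (Πᵢ : DerT ∅ P wᵢ bᵢ) → sizeT Πᵢ < s → SmallerDerivations s ds b w →
         SmallerDerivations s ((q , P) ∷ ds) ((q ·D bᵢ) ++ b) (q * wᵢ + w)

SmallerDerivations-≤ : ∀ {s s′ ds b w} → s ≤ s′ → SmallerDerivations s ds b w → SmallerDerivations s′ ds b w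
SmallerDerivations-≤ s≤s′ []              = []
SmallerDerivations-≤ s≤s′ (cons Π size Πs) = cons Π (ℕ.≤-trans size s≤s′) (SmallerDerivations-≤ s≤s′ Πs)

ReductDerivations : ℕ → MDist 0 → TDist → ℚ → Set
ReductDerivations s ds b w = Σ TDist λ b′ → Σ ℚ λ w′ → SmallerDerivations s ds b′ w′ × (b ≈D b′) × (w ≡ 1ℚ + w′)

⟶-mass : ∀ {n} {P : Term n} {ds} → P ⟶ ds → sumℚ (map proj₁ ds) ≡ 1ℚ
⟶-mass β                  = refl
⟶-mass letV               = refl
⟶-mass ⊕-red              = refl
⟶-mass (letC {ds = ds} r) = ≡.trans (cong sumℚ (sym (List.map-∘ ds))) (⟶-mass r)

letReducts : ∀ {n} → Term (suc n) → MDist n → MDist n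
letReducts M = map (λ pN → proj₁ pN , letT (proj₂ pN) M)

zero-letReducts : ∀ {M : Term 1} ds → Σ ℚ λ w → SmallerDerivations 2 (letReducts M ds) [] w × (w ≡ 0ℚ)
zero-letReducts []             = 0ℚ , [] , refl
zero-letReducts ((q , _) ∷ ds) with zero-letReducts ds
... | _ , Πs , refl = _ , cons zero-rule (s≤s (s≤s z≤n)) Πs , ≡.trans (ℚ.+-identityʳ _) (ℚ.*-zeroʳ q)

record BranchesSplit {n} (M : Term (suc n)) (a₁ a₂ : TDist) (ws : ℚ) (bs : TDist) (s : ℕ) : Set where
  constructor branchesSplit
  field
    {Δ₁ Δ₂}   : Ctx n
    {ws₁ ws₂} : ℚ
    {bs₁ bs₂} : TDist
    branches₁ : Branches M a₁ Δ₁ ws₁ bs₁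
    branches₂ : Branches M a₂ Δ₂ ws₂ bs₂
    weight    : ws ≡ ws₁ + ws₂
    type      : bs ≡ bs₁ ++ bs₂
    size      : s ≡ sizeBr branches₁ ℕ.+ sizeBr branches₂

Branches-split : ∀ {n} {M : Term (suc n)} a₁ {a₂ Δ ws bs} (Bs : Branches M (a₁ ++ a₂) Δ ws bs) →
                 BranchesSplit M a₁ a₂ ws bs (sizeBr Bs)
Branches-split []       Bs = branchesSplit [] Bs (sym (ℚ.+-identityˡ _)) refl refl
Branches-split (_ ∷ a₁) (cons {p = p} {w = w} {b = b} D 𝓜≈ Bs) with Branches-split a₁ Bs
... | branchesSplit {ws₁ = ws₁} {ws₂} {bs₁} {bs₂} B₁ B₂ refl refl size =
  branchesSplit (cons D 𝓜≈ B₁) B₂ (sym (ℚ.+-assoc (p * w) ws₁ ws₂)) (sym (List.++-assoc (p ·D b) bs₁ bs₂))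
    (≡.trans (cong (sizeT D ℕ.+_) size) (sym (ℕ.+-assoc (sizeT D) (sizeBr B₁) (sizeBr B₂))))

·D-·D : ∀ q p (b : TDist) → (q * p) ·D b ≡ q ·D (p ·D b)
·D-·D q p []            = refl
·D-·D q p ((r , 𝓜) ∷ b) = cong₂ _∷_ (cong (_, 𝓜) (ℚ.*-assoc q p r)) (·D-·D q p b)

record BranchesUnscaled {n} (M : Term (suc n)) (q : ℚ) (a : TDist) (ws : ℚ) (bs : TDist) (s : ℕ) : Set where
  constructor branchesUnscaled
  field
    {Δ′}     : Ctx n
    {ws′}    : ℚ
    {bs′}    : TDist
    branches : Branches M a Δ′ ws′ bs′
    weight   : ws ≡ q * ws′
    type     : bs ≡ q ·D bs′
    size     : sizeBr branches ≡ s

Branches-unscale : ∀ {n} {M : Term (suc n)} q a {Δ ws bs} (Bs : Branches M (q ·D a) Δ ws bs) →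
                   BranchesUnscaled M q a ws bs (sizeBr Bs)
Branches-unscale q []            []               = branchesUnscaled [] (sym (ℚ.*-zeroʳ q)) refl refl
Branches-unscale q ((p , _) ∷ a) (cons {w = w} {b = b} D 𝓜≈ Bs) with Branches-unscale q a Bs
... | branchesUnscaled {ws′ = ws′} {bs′} Bs′ refl refl size =
  branchesUnscaled (cons D 𝓜≈ Bs′)
    (≡.trans (cong (_+ q * ws′) (ℚ.*-assoc q p w)) (sym (ℚ.*-distribˡ-+ q (p * w) ws′)))
    (≡.trans (cong (_++ (q ·D bs′)) (·D-·D q p b)) (sym (List.map-++ _ (p ·D b) bs′)))
    (cong (sizeT D ℕ.+_) size)

letReduct-weight : ∀ q wᵢ wsᵢ ws w m →
                   q * (wsᵢ + wᵢ + 1ℚ) + (ws + w + m) ≡ (q * wsᵢ + ws) + (q * wᵢ + w) + (q + m)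
letReduct-weight = solve 6 (λ q wᵢ wsᵢ ws w m → q :* (wsᵢ :+ wᵢ :+ con 1ℚ) :+ (ws :+ w :+ m)
                                              := (q :* wsᵢ :+ ws) :+ (q :* wᵢ :+ w) :+ (q :+ m)) refl

letReducts-derivations : ∀ {M : Term 1} {s ds bN wN Δ ws bs} → SmallerDerivations s ds bN wN → (Bs : Branches M bN Δ ws bs) →
                         Σ TDist λ b → Σ ℚ λ w → SmallerDerivations (suc (s ℕ.+ sizeBr Bs)) (letReducts M ds) b w ×
                           (bs ≈D b) × (w ≡ ws + wN + sumℚ (map proj₁ ds))
letReducts-derivations [] [] = [] , 0ℚ , [] , ≈D-refl [] , refl
letReducts-derivations {s = s} (cons {q = q} {w = wN} {bᵢ = bᵢ} {wᵢ} Πᵢ Πᵢ<s Πs) Bs with Branches-split (q ·D bᵢ) Bs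
... | branchesSplit {ws₂ = ws₂} B₁ B₂ refl refl size with Branches-unscale q bᵢ B₁
... | branchesUnscaled {[]} {wsᵢ} {bsᵢ} B₁′ refl refl size₁ with letReducts-derivations Πs B₂
... | _ , _ , Πs′ , type , refl =
  _ , _ ,
  cons (let-rule Πᵢ B₁′) (s≤s (ℕ.+-mono-≤ Πᵢ<s B₁′≤Bs)) (SmallerDerivations-≤ (s≤s (ℕ.+-monoʳ-≤ s B₂≤Bs)) Πs′) ,
  ≈D.++⁺ˡ (q ·D bsᵢ) type ,
  letReduct-weight q wᵢ wsᵢ ws₂ wN _
  where
    B₁′≤Bs : sizeBr B₁′ ≤ sizeBr Bs
    B₁′≤Bs = ℕ.≤-trans (ℕ.≤-reflexive size₁) (ℕ.≤-trans (ℕ.m≤m+n _ _) (ℕ.≤-reflexive (sym size)))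

    B₂≤Bs : sizeBr B₂ ≤ sizeBr Bs
    B₂≤Bs = ℕ.≤-trans (ℕ.m≤n+m _ _) (ℕ.≤-reflexive (sym size))

-- (Zero) types every term with weight 0; the hypothesis 0 < w excludes it at the root, and a
-- let whose bound term is typed by (Zero) is treated separately.
NotZeroRule : ∀ {n} {Γ : Ctx n} {M w a} → DerT Γ M w a → Set
NotZeroRule zero-rule = ⊥
NotZeroRule _         = ⊤

0<w⇒NotZeroRule : ∀ {n} {Γ : Ctx n} {M w a} (Π : DerT Γ M w a) → 0ℚ <ℚ w → NotZeroRule Π
0<w⇒NotZeroRule zero-rule        0<0 = ℚ.<-irrefl refl 0<0
0<w⇒NotZeroRule (app-rule _ _ _) _   = tt
0<w⇒NotZeroRule (⊕-rule _ _)     _   = tt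
0<w⇒NotZeroRule (let-rule _ _)   _   = tt
0<w⇒NotZeroRule (val-rule _)     _   = tt

1·D-++-[] : ∀ (a : TDist) → (1ℚ ·D a) ++ [] ≡ a
1·D-++-[] []            = refl
1·D-++-[] ((p , 𝓜) ∷ a) = cong₂ _∷_ (cong (_, 𝓜) (ℚ.*-identityˡ p)) (1·D-++-[] a)

β-weight : ∀ w v → (1ℚ * (w + 1ℚ) + 0ℚ) + v ≡ 1ℚ + (1ℚ * (w + v) + 0ℚ)
β-weight = solve 2 (λ w v → (con 1ℚ :* (w :+ con 1ℚ) :+ con 0ℚ) :+ v := con 1ℚ :+ (con 1ℚ :* (w :+ v) :+ con 0ℚ)) refl

letV-weight : ∀ w v → (1ℚ * w + 0ℚ) + v + 1ℚ ≡ 1ℚ + (1ℚ * (w + v) + 0ℚ)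
letV-weight = solve 2 (λ w v → (con 1ℚ :* w :+ con 0ℚ) :+ v :+ con 1ℚ := con 1ℚ :+ (con 1ℚ :* (w :+ v) :+ con 0ℚ)) refl

⊕-red-weight : ∀ w v → ½ * w + ½ * v + 1ℚ ≡ 1ℚ + (½ * w + (½ * v + 0ℚ))
⊕-red-weight = solve 2 (λ w v → con ½ :* w :+ con ½ :* v :+ con 1ℚ := con 1ℚ :+ (con ½ :* w :+ (con ½ :* v :+ con 0ℚ))) refl

letC-weight : ∀ ws w → ws + (1ℚ + w) + 1ℚ ≡ 1ℚ + (ws + w + 1ℚ)
letC-weight = solve 2 (λ ws w → ws :+ (con 1ℚ :+ w) :+ con 1ℚ := con 1ℚ :+ (ws :+ w :+ con 1ℚ)) refl

mutual
  subject-reduction : ∀ {Γ : Ctx 0} {P w b} (Π : DerT Γ P w b) → NotZeroRule Π → ∀ {ds} → P ⟶ ds →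
                      ReductDerivations (sizeT Π) ds b w
  subject-reduction (app-rule (!-rule (cons {Γ = []} _ _ _ (λ-rule {w = w} ΠM) [])) (!-rule ΠV) 𝓜≈) _ β
    with substitution-lemma ΠM ΠV (≈M-sym 𝓜≈)
  ... | _ , a′ , Π′ , type , refl , size =
    _ , _ , cons Π′ (s≤s (ℕ.≤-trans size (ℕ.+-monoˡ-≤ (sizeB ΠV) (ℕ.≤-trans (ℕ.n≤1+n (sizeT ΠM)) (ℕ.m≤m+n (suc (sizeT ΠM)) 0))))) [] ,
    trans (≈D-sym type) (≈D-reflexive (sym (1·D-++-[] a′))) ,
    β-weight w _
  subject-reduction (app-rule _ (var-rule () _) _) _ β
  subject-reduction (let-rule zero-rule []) _ letV = _ , _ , cons zero-rule (s≤s (s≤s z≤n)) [] , ≈D-refl [] , refl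
  subject-reduction (let-rule (val-rule (var-rule () _)) _) _ letV
  subject-reduction (let-rule (val-rule (!-rule ΠV)) (cons {Δ = []} {w = w} ΠM 𝓜≈ [])) _ letV
    with substitution-lemma ΠM ΠV (≈M-sym 𝓜≈)
  ... | _ , _ , Π′ , type , refl , size =
    _ , _ , cons Π′ (s≤s (ℕ.≤-trans size (ℕ.≤-trans (ℕ.≤-reflexive (ℕ.+-comm (sizeT ΠM) (sizeB ΠV))) (ℕ.+-monoʳ-≤ (sizeB ΠV) (ℕ.m≤m+n (sizeT ΠM) 0))))) [] ,
    ≈D.++⁺ʳ [] (·D-cong 1ℚ (≈D-sym type)) ,
    letV-weight w _
  subject-reduction (⊕-rule {Γ = []} {Δ = []} {w = w} {v = v} {b = b} D E) _ ⊕-red =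
    _ , _ , cons D (s≤s (ℕ.m≤m+n _ _)) (cons E (s≤s (ℕ.m≤n+m _ _)) []) ,
    ≈D-reflexive (cong (_ ++_) (sym (List.++-identityʳ (½ ·D b)))) ,
    ⊕-red-weight w v
  subject-reduction (let-rule {M = M} zero-rule []) _ (letC {ds = ds} _) with zero-letReducts {M} ds
  ... | _ , Πs , refl = _ , _ , Πs , ≈D-refl [] , refl
  subject-reduction (let-rule ΠN@(app-rule _ _ _) Bs) _ (letC r) = subject-reduction-let ΠN tt Bs r
  subject-reduction (let-rule ΠN@(⊕-rule _ _)     Bs) _ (letC r) = subject-reduction-let ΠN tt Bs r
  subject-reduction (let-rule ΠN@(let-rule _ _)   Bs) _ (letC r) = subject-reduction-let ΠN tt Bs r
  subject-reduction (let-rule ΠN@(val-rule _)     Bs) _ (letC r) = subject-reduction-let ΠN tt Bs r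

  subject-reduction-let : ∀ {Γ Δ : Ctx 0} {N M v a ws bs} (ΠN : DerT Γ N v a) → NotZeroRule ΠN →
                          (Bs : Branches M a Δ ws bs) → ∀ {ds} → N ⟶ ds →
                          ReductDerivations (suc (sizeT ΠN ℕ.+ sizeBr Bs)) (letReducts M ds) bs (ws + v + 1ℚ)
  subject-reduction-let {ws = ws} ΠN nz Bs r with subject-reduction ΠN nz r
  ... | _ , wN , ΠNs , typeN , refl with Branches-realign Bs (≈D-sym typeN)
  ... | realigned Bs′ _ type refl size with letReducts-derivations ΠNs Bs′
  ... | _ , _ , Πs , type′ , refl =
    _ , _ , subst (λ t → SmallerDerivations (suc (sizeT ΠN ℕ.+ t)) _ _ _) size Πs ,
    trans (≈D-sym type) type′ ,
    ≡.trans (letC-weight ws wN) (cong (λ m → 1ℚ + (ws + wN + m)) (sym (⟶-mass r)))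

SmallerDerivations-tabulate : ∀ {s ds b w} → SmallerDerivations s ds b w →
  Σ (Fin (length ds) → ℚ) λ ws → Σ (Fin (length ds) → TDist) λ bs →
    ((i : Fin (length ds)) → Σ (DerT ∅ (proj₂ (lookup ds i)) (ws i) (bs i)) λ Πᵢ → sizeT Πᵢ < s)
    × (b ≡ concat (tabulate λ i → proj₁ (lookup ds i) ·D bs i))
    × (w ≡ sumℚ (tabulate λ i → proj₁ (lookup ds i) * ws i))
SmallerDerivations-tabulate [] = (λ ()) , (λ ()) , (λ ()) , refl , refl
SmallerDerivations-tabulate (cons {q = q} {bᵢ = bᵢ} {wᵢ} Πᵢ Πᵢ<s Πs) with SmallerDerivations-tabulate Πs
... | ws , bs , Πs′ , refl , refl =
  (λ { zero → wᵢ ; (suc i) → ws i }) , (λ { zero → bᵢ ; (suc i) → bs i }) ,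
  (λ { zero → Πᵢ , Πᵢ<s ; (suc i) → Πs′ i }) , refl , refl

mainTheorem6 : {P : Term 0} {w : ℚ} {b : TDist} (Π : DerT ∅ P w b) → 0ℚ <ℚ w →
    {ds : MDist 0} → P ⟶ ds →
    Σ (Fin (length ds) → ℚ) λ ws → Σ (Fin (length ds) → TDist) λ bs →
      ((i : Fin (length ds)) →
          Σ (DerT ∅ (proj₂ (lookup ds i)) (ws i) (bs i)) λ Πi → sizeT Πi < sizeT Π)
      × (b ≈D concat (tabulate λ i → proj₁ (lookup ds i) ·D bs i))
      × (w ≡ 1ℚ + sumℚ (tabulate λ i → proj₁ (lookup ds i) * ws i))
mainTheorem6 Π 0<w r with subject-reduction Π (0<w⇒NotZeroRule Π 0<w) r
... | _ , _ , Πs , type , weight with SmallerDerivations-tabulate Πs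
... | ws , bs , Πᵢ , refl , refl = ws , bs , Πᵢ , type , weight
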